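{- Let $R$ be the graph defined below. Then $R$ is planar, admits a Hamiltonian path with endpoints $x$ and $y$, has no feedback vertex set of size at most two, has a feedback vertex set of size three containing $x'$ or $y'$, and has no feedback vertex set of size three containing $x$ or $y$.
   Context: A feedback vertex set of a graph $G$ is a vertex set $U$ such that $G-U$ is acyclic. $C_4*K_1$ denotes the wheel on five vertices: a 4-cycle $a_1a_2a_3a_4a_1$ plus a center vertex $c$ adjacent to $a_1,a_2,a_3,a_4$. The graph $R$ is obtained from $C_4*K_1$ by adding a vertex $x'$ adjacent to $a_1$ and $a_4$, a vertex $y'$ adjacent to $a_2$ and $a_3$ (so that every vertex of the wheel has degree four), the edge $\{x',y'\}$, a vertex $x$ adjacent only to $x'$, and a vertex $y$ adjacent only to $y'$. -}

module Defs where

open import Data.Nat using (ℕ; zero; suc; _+_; _*_; _≤ᵇ_; _≤_)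
open import Data.Bool using (Bool; true; false; _∧_; _∨_; not; T)
open import Data.Fin using (Fin; zero; suc; toℕ; _≟_)
open import Data.Product using (Σ; _×_; _,_; ∃)
open import Data.List using (List; []; _∷_; _++_; [_]; length; map; concatMap; filterᵇ; allFin; upTo; null)
open import Data.Bool.ListAction using (all; any)
open import Data.List.Relation.Unary.All using (All)
open import Data.List.Relation.Unary.Unique.Propositional using (Unique)
open import Data.List.Relation.Unary.Linked using (Linked)
open import Data.List.Membership.Propositional using () renaming (_∈_ to _∈ₗ_)
open import Data.Fin.Subset using (Subset; _∉_)
open import Relation.Nullary using (¬_)
open import Relation.Nullary.Decidable using (⌊_⌋)
open import Relation.Binary.PropositionalEquality using (_≡_)

record Graph (n : ℕ) : Set where
  field
    adj    : Fin n → Fin n → Bool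
    sym    : ∀ u v → adj u v ≡ adj v u
    irrefl : ∀ v → adj v v ≡ false
open Graph public

Adj : ∀ {n} → Graph n → Fin n → Fin n → Set
Adj G u v = T (adj G u v)

iter : ∀ {A : Set} → (A → A) → ℕ → A → A
iter f zero    a = a
iter f (suc k) a = f (iter f k a)

count : ∀ {A : Set} → (A → Bool) → List A → ℕ
count p xs = length (filterᵇ p xs)

record Cycle {n} (G : Graph n) : Set where
  constructor cycle
  field
    start    : Fin n
    rest     : List (Fin n)
    long     : 2 ≤ length rest
    distinct : Unique (start ∷ rest)
    closed   : Linked (Adj G) (start ∷ rest ++ [ start ])
open Cycle public

cycleVertices : ∀ {n} {G : Graph n} → Cycle G → List (Fin n)
cycleVertices C = start C ∷ rest C

-- G − U is acyclic: G has no cycle all of whose vertices lie outside U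
-- (the cycles of the induced subgraph G − U are exactly these).
AcyclicWithout : ∀ {n} → Graph n → Subset n → Set
AcyclicWithout G U = ¬ (Σ (Cycle G) λ C → All (λ v → v ∉ U) (cycleVertices C))

IsFVS : ∀ {n} → Graph n → Subset n → Set
IsFVS G U = AcyclicWithout G U

HamiltonianPath : ∀ {n} → Graph n → Fin n → Fin n → Set
HamiltonianPath {n} G s t =
  Σ (List (Fin n)) λ ws →
    Unique (s ∷ ws ++ [ t ]) ×
    (∀ v → v ∈ₗ (s ∷ ws ++ [ t ])) ×
    Linked (Adj G) (s ∷ ws ++ [ t ])

-- Planarity, via combinatorial embeddings (rotation systems) and the
-- Heffter–Edmonds–Ringel rotation principle: a graph is planar iff it has a
-- rotation system whose Euler genus is 0.

module _ {n : ℕ} (G : Graph n) where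

  Dart : Set
  Dart = Fin n × Fin n

  darts : List Dart
  darts = concatMap (λ u → map (λ v → (u , v)) (filterᵇ (adj G u) (allFin n))) (allFin n)

  IsRotation : (Fin n → Fin n → Fin n) → Set
  IsRotation ρ =
    (∀ v u → Adj G v u → Adj G v (ρ v u)) ×
    (∀ v u w → Adj G v u → Adj G v w → ∃ λ k → iter (ρ v) k u ≡ w)

  facePerm : (Fin n → Fin n → Fin n) → Dart → Dart
  facePerm ρ (u , v) = (v , ρ v u)

  key : Dart → ℕ
  key (u , v) = toℕ u * n + toℕ v

  -- d is the key-minimal dart of its face orbit (orbits have length ≤ #darts)
  isFaceRep : (Fin n → Fin n → Fin n) → Dart → Bool
  isFaceRep ρ d = all (λ k → key d ≤ᵇ key (iter (facePerm ρ) k d)) (upTo (length darts))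

  faces : (Fin n → Fin n → Fin n) → ℕ
  faces ρ = count (isFaceRep ρ) darts

  -- number of isolated vertices (each counts as one face of its component)
  isolated : ℕ
  isolated = count (λ v → null (filterᵇ (adj G v) (allFin n))) (allFin n)

  reachStep : (Fin n → Bool) → Fin n → Bool
  reachStep S w = S w ∨ any (λ u → S u ∧ adj G u w) (allFin n)

  reach : Fin n → Fin n → Bool
  reach v = iter reachStep n (λ w → ⌊ v ≟ w ⌋)

  isCompRep : Fin n → Bool
  isCompRep v = all (λ w → not (reach v w) ∨ (toℕ v ≤ᵇ toℕ w)) (allFin n)

  components : ℕ
  components = count isCompRep (allFin n)

  -- Euler's formula summed over components, with Euler genus 0:
  --   |V| − |E| + (faces + isolated) = 2·(#components),  where |E| = #darts / 2
  Planar : Set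
  Planar = Σ (Fin n → Fin n → Fin n) λ ρ →
    IsRotation ρ × (2 * (n + faces ρ + isolated) ≡ length darts + 4 * components)

a₁ a₂ a₃ a₄ c x' y' x y : Fin 9
a₁ = zero
a₂ = suc zero
a₃ = suc (suc zero)
a₄ = suc (suc (suc zero))
c  = suc (suc (suc (suc zero)))
x' = suc (suc (suc (suc (suc zero))))
y' = suc (suc (suc (suc (suc (suc zero)))))
x  = suc (suc (suc (suc (suc (suc (suc zero))))))
y  = suc (suc (suc (suc (suc (suc (suc (suc zero)))))))

R-edges : List (Fin 9 × Fin 9)
R-edges =
  (a₁ , a₂) ∷ (a₂ , a₃) ∷ (a₃ , a₄) ∷ (a₄ , a₁) ∷
  (c , a₁) ∷ (c , a₂) ∷ (c , a₃) ∷ (c , a₄) ∷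
  (x' , a₁) ∷ (x' , a₄) ∷ (y' , a₂) ∷ (y' , a₃) ∷ (x' , y') ∷
  (x , x') ∷ (y , y') ∷ []

isEdge : Fin 9 → Fin 9 → Bool
isEdge u v = any (λ { (p , q) → ⌊ p ≟ u ⌋ ∧ ⌊ q ≟ v ⌋ }) R-edges

R-adj : Fin 9 → Fin 9 → Bool
R-adj u v = isEdge u v ∨ isEdge v u

private
  ∨-comm' : ∀ a b → (a ∨ b) ≡ (b ∨ a)
  ∨-comm' false false = _≡_.refl
  ∨-comm' false true  = _≡_.refl
  ∨-comm' true  false = _≡_.refl
  ∨-comm' true  true  = _≡_.refl

  R-irrefl : ∀ v → R-adj v v ≡ false
  R-irrefl zero = _≡_.refl
  R-irrefl (suc zero) = _≡_.refl
  R-irrefl (suc (suc zero)) = _≡_.refl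
  R-irrefl (suc (suc (suc zero))) = _≡_.refl
  R-irrefl (suc (suc (suc (suc zero)))) = _≡_.refl
  R-irrefl (suc (suc (suc (suc (suc zero))))) = _≡_.refl
  R-irrefl (suc (suc (suc (suc (suc (suc zero)))))) = _≡_.refl
  R-irrefl (suc (suc (suc (suc (suc (suc (suc zero))))))) = _≡_.refl
  R-irrefl (suc (suc (suc (suc (suc (suc (suc (suc zero)))))))) = _≡_.refl

R : Graph 9
R = record { adj = R-adj ; sym = λ u v → ∨-comm' (isEdge u v) (isEdge v u) ; irrefl = R-irrefl }

-- Every vertex of a cycle has two distinct neighbours on it (rotate the cycle to start there),
-- so a vertex of degree at most one in G − U lies on no cycle of G − U. Peeling such vertices
-- shows that R − {a₂, c, x'} is acyclic. The pendant vertices x and y lie on no cycle, so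
-- dropping one of them from a feedback vertex set of size three would leave one of size two;
-- but every set of at most two vertices misses one of six explicit cycles of R (checked over
-- all subsets).
module Submission where

open import Defs
open import Data.Nat using (ℕ; _≤_; _<_; _≤?_; s≤s; s≤s⁻¹)
open import Data.Nat.Properties using (suc-injective; anyUpTo?)
open import Data.Bool using (T; if_then_else_)
open import Data.Fin using (Fin; _≟_)
open import Data.Fin.Properties using (all?)
open import Data.Fin.Subset using (Subset; _∈_; _∉_; ∣_∣; ⊤; ⁅_⁆; _∪_; _-_)
open import Data.Fin.Subset.Properties
  using (_∈?_; ∈⊤; x∈⁅y⁆⇒x≡y; x∈p∪q⁻; x∈p∧x≢y⇒x∈p-y; x∈p⇒∣p-x∣<∣p∣; anySubset?)
open import Data.List using (List; []; _∷_; _++_; [_]; length; initLast; _∷ʳ′_)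
open import Data.List.Properties using (++-assoc)
open import Data.List.Membership.Propositional using () renaming (_∈_ to _∈ₗ_)
open import Data.List.Membership.Propositional.Properties using (∈-∃++; ∈-++⁺ʳ)
import Data.List.Membership.DecPropositional as ListMembership
open import Data.List.Relation.Unary.All as All using (All)
open import Data.List.Relation.Unary.Any using (Any; here; there; any?; satisfied)
open import Data.List.Relation.Unary.AllPairs using (_∷_)
open import Data.List.Relation.Unary.Linked as Linked using (Linked; [-]; _∷_; linked?)
open import Data.List.Relation.Unary.Unique.Propositional using (Unique)
import Data.List.Relation.Unary.Unique.DecPropositional as UniqueDec
open import Data.List.Relation.Binary.Permutation.Propositional
  using (_↭_; ↭-refl; ↭-sym; ↭⇒↭ₛ)
open import Data.List.Relation.Binary.Permutation.Propositional.Properties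
  using (++-comm; ↭-length; ∈-resp-↭)
import Data.List.Relation.Binary.Permutation.Setoid.Properties as PermutationSetoid
open import Data.Product using (Σ; ∃; ∃₂; _×_; _,_; proj₂)
import Data.Product as Product
open import Data.Sum using (_⊎_; inj₁; inj₂)
import Data.Sum as Sum
open import Function using (_∘_)
open import Level using (Level)
open import Relation.Binary using (Rel)
open import Relation.Binary.PropositionalEquality as ≡ using (_≡_; _≢_; refl)
open import Relation.Nullary using (¬_; Dec; yes; no; does)
open import Relation.Nullary.Decidable
  using (True; toWitness; from-yes; decidable-stable; T?; ¬?; _→-dec_)
open import Relation.Unary using (Pred; Decidable)

private
  variable
    ℓ : Level
    n : ℕ
    G : Graph n
    U W : Subset n
    v : Fin n
    xs ys : List (Fin n)

module _ {a} {A : Set a} {_~_ : Rel A ℓ} where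

  Linked-split : ∀ xs {m ys} → Linked _~_ (xs ++ m ∷ ys) →
                 Linked _~_ (xs ++ [ m ]) × Linked _~_ (m ∷ ys)
  Linked-split []           l       = [-] , l
  Linked-split (x ∷ [])     (r ∷ l) = r ∷ [-] , l
  Linked-split (x ∷ y ∷ xs) (r ∷ l) = Product.map₁ (r ∷_) (Linked-split (y ∷ xs) l)

  Linked-join : ∀ xs {m ys} → Linked _~_ (xs ++ [ m ]) → Linked _~_ (m ∷ ys) →
                Linked _~_ (xs ++ m ∷ ys)
  Linked-join []           _       l = l
  Linked-join (x ∷ [])     (r ∷ _) l = r ∷ l
  Linked-join (x ∷ y ∷ xs) (r ∷ k) l = r ∷ Linked-join (y ∷ xs) k l

Adj-sym : (G : Graph n) → ∀ {u w} → Adj G u w → Adj G w u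
Adj-sym G {u} {w} = ≡.subst T (sym G u w)

adj? : (G : Graph n) → ∀ u w → Dec (Adj G u w)
adj? G u w = T? (adj G u w)

HasTwoNeighboursIn : Graph n → Fin n → List (Fin n) → Set
HasTwoNeighboursIn G v xs = ∃₂ λ u w → u ≢ w × Adj G v u × Adj G v w × u ∈ₗ xs × w ∈ₗ xs

HasTwoNeighboursIn-mono : (∀ {u} → u ∈ₗ xs → u ∈ₗ ys) →
                          HasTwoNeighboursIn G v xs → HasTwoNeighboursIn G v ys
HasTwoNeighboursIn-mono xs⊆ys (u , w , u≢w , v~u , v~w , u∈xs , w∈xs) =
  u , w , u≢w , v~u , v~w , xs⊆ys u∈xs , xs⊆ys w∈xs

module _ {G : Graph n} where

  rotate : (C : Cycle G) → v ∈ₗ cycleVertices C →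
           Σ (Cycle G) λ D → start D ≡ v × cycleVertices D ↭ cycleVertices C
  rotate C (here refl) = C , refl , ↭-refl
  rotate {v} (cycle s rest long distinct closed) (there v∈rest) with ∈-∃++ v∈rest
  ... | p , q , refl = cycle v (q ++ s ∷ p) long′ distinct′ closed′ , refl , σ
    where
    σ : v ∷ q ++ s ∷ p ↭ s ∷ p ++ v ∷ q
    σ = ++-comm (v ∷ q) (s ∷ p)

    long′ : 2 ≤ length (q ++ s ∷ p)
    long′ = ≡.subst (2 ≤_) (≡.sym (suc-injective (↭-length σ))) long

    distinct′ : Unique (v ∷ q ++ s ∷ p)
    distinct′ = PermutationSetoid.Unique-resp-↭ (≡.setoid (Fin n)) (↭⇒↭ₛ (↭-sym σ)) distinct

    s⋯v⋯s : Linked (Adj G) ((s ∷ p) ++ v ∷ q ++ [ s ])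
    s⋯v⋯s = ≡.subst (Linked (Adj G) ∘ (s ∷_)) (++-assoc p (v ∷ q) [ s ]) closed

    closed′ : Linked (Adj G) (v ∷ (q ++ s ∷ p) ++ [ v ])
    closed′ with s⋯v , v⋯s ← Linked-split (s ∷ p) s⋯v⋯s =
      ≡.subst (Linked (Adj G) ∘ (v ∷_)) (≡.sym (++-assoc q (s ∷ p) [ v ]))
              (Linked-join (v ∷ q) v⋯s s⋯v)

  start-neighbours : (C : Cycle G) → HasTwoNeighboursIn G (start C) (rest C)
  start-neighbours (cycle s (r ∷ rs) long distinct closed) with initLast rs
  start-neighbours (cycle s (r ∷ _) (s≤s ()) _ _) | []
  start-neighbours (cycle s (r ∷ _) _ (_ ∷ r∉ ∷ _) closed) | ps ∷ʳ′ l =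
    r , l , r≢l , Linked.head closed , Adj-sym G l~s , here refl , there l∈rs
    where
    l∈rs : l ∈ₗ ps ++ [ l ]
    l∈rs = ∈-++⁺ʳ ps (here refl)

    r≢l : r ≢ l
    r≢l refl = All.lookup r∉ l∈rs refl

    s⋯l∷s : Linked (Adj G) ((s ∷ r ∷ ps) ++ l ∷ [ s ])
    s⋯l∷s = ≡.subst (λ xs → Linked (Adj G) (s ∷ r ∷ xs)) (++-assoc ps [ l ] [ s ]) closed

    l~s : Adj G l s
    l~s = Linked.head (proj₂ (Linked-split (s ∷ r ∷ ps) s⋯l∷s))

  cycle-neighbours : (C : Cycle G) → v ∈ₗ cycleVertices C →
                     HasTwoNeighboursIn G v (cycleVertices C)
  cycle-neighbours C v∈C with D , refl , σ ← rotate C v∈C =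
    HasTwoNeighboursIn-mono {G = G} (∈-resp-↭ σ ∘ there) (start-neighbours D)

DegreeAtMostOne : Graph n → Fin n → Set
DegreeAtMostOne {n} G v = ∀ (u w : Fin n) → Adj G v u → Adj G v w → u ≡ w

DegreeAtMostOneWithout : Graph n → Subset n → Fin n → Set
DegreeAtMostOneWithout {n} G U v =
  ∀ (u w : Fin n) → Adj G v u → Adj G v w → u ∉ U → w ∉ U → u ≡ w

degreeAtMostOne? : (G : Graph n) → Decidable (DegreeAtMostOne G)
degreeAtMostOne? G v = all? λ u → all? λ w → adj? G v u →-dec adj? G v w →-dec u ≟ w

degreeAtMostOneWithout? : (G : Graph n) (U : Subset n) → Decidable (DegreeAtMostOneWithout G U)
degreeAtMostOneWithout? G U v = all? λ u → all? λ w →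
  adj? G v u →-dec adj? G v w →-dec ¬? (u ∈? U) →-dec ¬? (w ∈? U) →-dec u ≟ w

IsFVS-⊤ : IsFVS G ⊤
IsFVS-⊤ (_ , s∉⊤ All.∷ _) = s∉⊤ ∈⊤

prune : DegreeAtMostOneWithout G U v → (∀ {u} → u ∈ W → u ∈ U ⊎ u ≡ v) →
        IsFVS G W → IsFVS G U
prune {W = W} leaf W⊆U+v fvs (C , C-avoids-U) = fvs (C , All.tabulate C-avoids-W)
  where
  C-avoids-W : ∀ {u} → u ∈ₗ cycleVertices C → u ∉ W
  C-avoids-W u∈C u∈W with W⊆U+v u∈W
  ... | inj₁ u∈U = All.lookup C-avoids-U u∈C u∈U
  ... | inj₂ refl with a , b , a≢b , v~a , v~b , a∈C , b∈C ← cycle-neighbours C u∈C =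
    a≢b (leaf a b v~a v~b (All.lookup C-avoids-U a∈C) (All.lookup C-avoids-U b∈C))

prune-∪ : DegreeAtMostOneWithout G U v → IsFVS G (U ∪ ⁅ v ⁆) → IsFVS G U
prune-∪ {U = U} {v = v} leaf = prune leaf (Sum.map₂ (x∈⁅y⁆⇒x≡y v) ∘ x∈p∪q⁻ U ⁅ v ⁆)

IsFVS-remove-pendant : DegreeAtMostOne G v → IsFVS G U → IsFVS G (U - v)
IsFVS-remove-pendant {v = v} {U = U} pendant =
  prune (λ u w v~u v~w _ _ → pendant u w v~u v~w) U⊆U-v+v
  where
  U⊆U-v+v : ∀ {u} → u ∈ U → u ∈ U - v ⊎ u ≡ v
  U⊆U-v+v {u} u∈U with u ≟ v
  ... | yes u≡v = inj₂ u≡v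
  ... | no  u≢v = inj₁ (x∈p∧x≢y⇒x∈p-y u∈U u≢v)

Avoids : {G : Graph n} → Subset n → Cycle G → Set
Avoids U C = All (_∉ U) (cycleVertices C)

avoids? : (U : Subset n) → Decidable (Avoids {G = G} U)
avoids? U C = All.all? (λ v → ¬? (v ∈? U)) (cycleVertices C)

cycle! : (s : Fin n) (rest : List (Fin n)) →
         {True (2 ≤? length rest)} →
         {True (UniqueDec.unique? _≟_ (s ∷ rest))} →
         {True (linked? (adj? G) (s ∷ rest ++ [ s ]))} →
         Cycle G
cycle! s rest {long} {distinct} {closed} =
  cycle s rest (toWitness long) (toWitness distinct) (toWitness closed)

hamiltonianPath! : (G : Graph n) (s t : Fin n) (ws : List (Fin n)) →
                   {True (UniqueDec.unique? _≟_ (s ∷ ws ++ [ t ]))} →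
                   {True (all? λ v → ListMembership._∈?_ _≟_ v (s ∷ ws ++ [ t ]))} →
                   {True (linked? (adj? G) (s ∷ ws ++ [ t ]))} →
                   HamiltonianPath G s t
hamiltonianPath! G s t ws {distinct} {spanning} {linked} =
  ws , toWitness distinct , toWitness spanning , toWitness linked

allSubset? : {P : Pred (Subset n) ℓ} → Decidable P → Dec (∀ U → P U)
allSubset? P? with anySubset? (¬? ∘ P?)
... | yes (U , ¬PU) = no λ ∀P → ¬PU (∀P U)
... | no  ∄¬P       = yes λ U → decidable-stable (P? U) (λ ¬PU → ∄¬P (U , ¬PU))

cyclicSuccessor : List (Fin n) → Fin n → Fin n
cyclicSuccessor          []           u = u
cyclicSuccessor {n} (first ∷ order) u = go (first ∷ order)
  where
  go : List (Fin n) → Fin n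
  go []            = u
  go (w ∷ [])      = if does (w ≟ u) then first else u
  go (w ∷ w′ ∷ ws) = if does (w ≟ u) then w′ else go (w′ ∷ ws)

rotationSystem : List (Fin n × List (Fin n)) → Fin n → Fin n → Fin n
rotationSystem []                      v u = u
rotationSystem ((w , order) ∷ orders) v =
  if does (w ≟ v) then cyclicSuccessor order else rotationSystem orders v

R-ρ : Fin 9 → Fin 9 → Fin 9
R-ρ = rotationSystem
  ( (a₁ , x' ∷ a₄ ∷ c ∷ a₂ ∷ [])
  ∷ (a₂ , c ∷ a₃ ∷ y' ∷ a₁ ∷ [])
  ∷ (a₃ , y' ∷ a₂ ∷ c ∷ a₄ ∷ [])
  ∷ (a₄ , a₃ ∷ c ∷ a₁ ∷ x' ∷ [])
  ∷ (c  , a₄ ∷ a₃ ∷ a₂ ∷ a₁ ∷ [])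
  ∷ (x' , a₄ ∷ a₁ ∷ y' ∷ x ∷ [])
  ∷ (y' , a₃ ∷ y ∷ x' ∷ a₂ ∷ [])
  ∷ (x  , x' ∷ [])
  ∷ (y  , y' ∷ [])
  ∷ [])

R-planar : Planar R
R-planar = R-ρ , (stays-in-neighbourhood , reaches-all-neighbours) , refl
  where
  stays-in-neighbourhood : ∀ v u → Adj R v u → Adj R v (R-ρ v u)
  stays-in-neighbourhood = from-yes (all? λ v → all? λ u → adj? R v u →-dec adj? R v (R-ρ v u))

  within-four-steps : ∀ v u w → Adj R v u → Adj R v w → ∃ λ k → k < 4 × iter (R-ρ v) k u ≡ w
  within-four-steps = from-yes (all? λ v → all? λ u → all? λ w →
    adj? R v u →-dec adj? R v w →-dec anyUpTo? (λ k → iter (R-ρ v) k u ≟ w) 4)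

  reaches-all-neighbours : ∀ v u w → Adj R v u → Adj R v w → ∃ λ k → iter (R-ρ v) k u ≡ w
  reaches-all-neighbours v u w v~u v~w = Product.map₂ proj₂ (within-four-steps v u w v~u v~w)

R-hamiltonianPath : HamiltonianPath R x y
R-hamiltonianPath = hamiltonianPath! R x y (x' ∷ a₁ ∷ c ∷ a₄ ∷ a₃ ∷ a₂ ∷ y' ∷ [])

R-cycles : List (Cycle R)
R-cycles =
  cycle! a₁ (a₂ ∷ c ∷ []) ∷
  cycle! a₃ (a₄ ∷ c ∷ []) ∷
  cycle! a₁ (a₄ ∷ x' ∷ []) ∷
  cycle! a₂ (a₃ ∷ y' ∷ []) ∷
  cycle! a₁ (c ∷ a₃ ∷ y' ∷ x' ∷ []) ∷
  cycle! a₂ (c ∷ a₄ ∷ x' ∷ y' ∷ []) ∷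
  []

small-sets-miss-an-R-cycle : ∀ U → ∣ U ∣ ≤ 2 → Any (Avoids U) R-cycles
small-sets-miss-an-R-cycle =
  from-yes (allSubset? λ U → ∣ U ∣ ≤? 2 →-dec any? (avoids? U) R-cycles)

no-FVS-of-size-two : ∀ U → ∣ U ∣ ≤ 2 → ¬ IsFVS R U
no-FVS-of-size-two U |U|≤2 fvs = fvs (satisfied (small-sets-miss-an-R-cycle U |U|≤2))

pendant-in-no-FVS-of-size-three : DegreeAtMostOne R v → ∀ U → ∣ U ∣ ≡ 3 → IsFVS R U → v ∉ U
pendant-in-no-FVS-of-size-three {v = v} pendant U |U|≡3 fvs v∈U =
  no-FVS-of-size-two (U - v) (s≤s⁻¹ (≡.subst (∣ U - v ∣ <_) |U|≡3 (x∈p⇒∣p-x∣<∣p∣ v∈U)))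
    (IsFVS-remove-pendant pendant fvs)

FVS-with-x' : Subset 9
FVS-with-x' = ⁅ a₂ ⁆ ∪ ⁅ c ⁆ ∪ ⁅ x' ⁆

-- R − {a₂, c, x'} is the path a₁ a₄ a₃ y' y plus the isolated vertex x.
FVS-with-x'-isFVS : IsFVS R FVS-with-x'
FVS-with-x'-isFVS = peel x (peel y (peel a₁ (peel y' (peel a₃ (peel a₄ IsFVS-⊤)))))
  where
  peel : ∀ {U} v → {True (degreeAtMostOneWithout? R U v)} → IsFVS R (U ∪ ⁅ v ⁆) → IsFVS R U
  peel v {leaf} = prune-∪ (toWitness leaf)

lemma6 : Planar R
    × HamiltonianPath R x y
    × (∀ (U : Subset 9) → ∣ U ∣ ≤ 2 → ¬ IsFVS R U)
    × Σ (Subset 9) (λ U → ∣ U ∣ ≡ 3 × IsFVS R U × (x' ∈ U ⊎ y' ∈ U))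
    × (∀ (U : Subset 9) → ∣ U ∣ ≡ 3 → IsFVS R U → ¬ (x ∈ U ⊎ y ∈ U))
lemma6 =
  R-planar ,
  R-hamiltonianPath ,
  no-FVS-of-size-two ,
  (FVS-with-x' , refl , FVS-with-x'-isFVS , inj₁ (from-yes (x' ∈? FVS-with-x'))) ,
  λ U |U|≡3 fvs → Sum.[ pendant-in-no-FVS-of-size-three x-pendant U |U|≡3 fvs
                      , pendant-in-no-FVS-of-size-three y-pendant U |U|≡3 fvs ]
  where
  x-pendant : DegreeAtMostOne R x
  x-pendant = from-yes (degreeAtMostOne? R x)

  y-pendant : DegreeAtMostOne R y
  y-pendant = from-yes (degreeAtMostOne? R y)
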